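{- A triple $(X,\sigma,\nu)$, with $X\in\mathcal S$, $\sigma:\delta(X)\hat\otimes X\to X$ and $\nu:J\to\delta(X)$, is a relevant substitution algebra if and only if it satisfies (a) $\sigma\circ(\nu\hat\otimes\mathrm{id}_X)=\lambda_X$, (b) $\delta(\sigma)\circ\mathsf{str}'_{\delta X,X}\circ(\mathrm{id}_{\delta X}\hat\otimes\nu)=r_{\delta X}$, and the extended substitution lemma $$\sigma\circ(\delta(\sigma)\hat\otimes\mathrm{id}_X)=\sigma^\dagger\circ\Sigma^\dagger_{\mathsf{sub}}(\mathrm{id}_X,\sigma)\circ\mathbf{str}^{\mathsf{sub}\dagger}_{X,\delta X,X}\circ(\mathbf{swap}^{\mathsf{sub}}_X\hat\otimes\mathrm{id}_X):\delta(\delta X\hat\otimes X)\hat\otimes X\to X.$$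
   Context: Let $\mathbb{S}$ be the category whose objects are the sets $\mathbf{n}=\{1,\dots,n\}$ ($n\in\mathbb{N}$) and whose morphisms are surjections; strict monoidal with $\mathbf n\otimes\mathbf m=\mathbf{n+m}$ (elements of $\mathbf m$ after those of $\mathbf n$, morphisms blockwise), unit $\mathbf 0$; $s:\mathbf 2\to\mathbf 2$ the transposition, $c:\mathbf 2\to\mathbf 1$ the unique map, $\nabla_n:\mathbf{n+n}\to\mathbf n$ the codiagonal. $\mathcal S=\mathbf{Set}^{\mathbb S}$. Day convolution $(X\hat\otimes Y)(\mathbf n)=\int^{\mathbf m_1,\mathbf m_2}X(\mathbf m_1)\times Y(\mathbf m_2)\times\mathbb S(\mathbf{m_1+m_2},\mathbf n)$, classes $[x,y,f]$, unit $J=\mathbb S(\mathbf 0,-)$; symmetric monoidal closed (distributes over coproducts); associators suppressed, unitors $\lambda,r$, symmetry $\gamma$; diagonal $d_Z:Z\to Z\hat\otimes Z$, $z\in Z(\mathbf n)\mapsto[z,z,\nabla_n]$. $\delta:\mathcal S\to\mathcal S$, $\delta(X)(\mathbf n)=X(\mathbf{n+1})$, $\delta(X)(f)=X(f\otimes\mathrm{id}_{\mathbf 1})$. $\mathsf{swap}_X:\delta^2X\to\delta^2X$ and $\mathsf{cont}_X:\delta^2X\to\delta X$ have components $X(\mathrm{id}_{\mathbf n}\otimes s)$ and $X(\mathrm{id}_{\mathbf n}\otimes c)$. Left strength $\mathsf{str}'_{X,Y}:X\hat\otimes\delta Y\to\delta(X\hat\otimes Y)$, $[x,y,f]\mapsto[x,y,f\otimes\mathrm{id}_{\mathbf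 1}]$; right strength $\mathsf{str}_{X,Y}:\delta X\hat\otimes Y\to\delta(X\hat\otimes Y)$, $[x,y,f]\mapsto[x,y,(f\otimes\mathrm{id}_{\mathbf 1})\circ\theta]$ ($x\in X(\mathbf{m_1+1})$, $y\in Y(\mathbf m_2)$), $\theta:\mathbf{m_1+1+m_2}\to\mathbf{m_1+m_2+1}$ fixing $1..m_1$, $m_1+1\mapsto m_1+m_2+1$, $m_1+1+i\mapsto m_1+i$. $\rho_{X,Y}=\mathsf{cont}_{X\hat\otimes Y}\circ\delta(\mathsf{str}'_{X,Y})\circ\mathsf{str}_{X,\delta Y}:\delta X\hat\otimes\delta Y\to\delta(X\hat\otimes Y)$. The morphism $[\mathsf{str}_{X,Y},\mathsf{str}'_{X,Y},\rho_{X,Y}]:\delta X\hat\otimes Y+X\hat\otimes\delta Y+\delta X\hat\otimes\delta Y\to\delta(X\hat\otimes Y)$ is an isomorphism with inverse $\mathcal H_{X,Y}$. $\Sigma_{\mathsf{sub}}(X)=\delta X\hat\otimes X$ with strength $\mathbf{str}^{\mathsf{sub}}_{Y,Z}=(\mathsf{str}_{Y,Z}\hat\otimes\mathrm{id})\circ(\mathrm{id}\hat\otimes\gamma_{Y,Z}\hat\otimes\mathrm{id})\circ(\mathrm{id}\hat\otimes\mathrm{id}\hat\otimes d_Z):\delta Y\hat\otimes Y\hat\otimes Z\to\delta(Y\hat\otimes Z)\hat\otimes(Y\hat\otimes Z)$. A relevant substitution algebra is $(X,\sigma,\nu)$ satisfying (a), (b) above and (c) $\sigma\circ(\mathrm{id}_{\delta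 X}\hat\otimes\sigma)=\sigma\circ(\delta\sigma\hat\otimes\mathrm{id})\circ(\mathsf{str}'_{\delta X,X}\hat\otimes\mathrm{id})$ on $\delta X\hat\otimes\delta X\hat\otimes X$; (d) $\sigma\circ(\delta\sigma\hat\otimes\mathrm{id})\circ(\mathsf{str}_{\delta X,X}\hat\otimes\mathrm{id})=\sigma\circ(\delta\sigma\hat\otimes\mathrm{id})\circ(\mathsf{str}_{\delta X,X}\hat\otimes\mathrm{id})\circ(\mathrm{id}_{\delta^2X}\hat\otimes\gamma_{X,X})\circ(\mathsf{swap}_X\hat\otimes\mathrm{id}_{X\hat\otimes X})$ on $\delta^2X\hat\otimes X\hat\otimes X$; (f) $\sigma\circ(\delta\sigma\hat\otimes\mathrm{id}_X)\circ(\rho_{\delta X,X}\hat\otimes\mathrm{id}_X)=\sigma\circ(\delta\sigma\hat\otimes\sigma)\circ\mathbf{str}^{\mathsf{sub}}_{\delta X,X}\circ(\mathsf{swap}_X\hat\otimes\mathrm{id}_{\delta X}\hat\otimes\mathrm{id}_X)$ on $\delta^2X\hat\otimes\delta X\hat\otimes X$. Derived substitution functor: $\Sigma^\dagger_{\mathsf{sub}}(X,Y)=\delta Y\hat\otimes X+\delta X\hat\otimes Y+\delta Y\hat\otimes Y$. $\mathbf{swap}^{\mathsf{sub}}_X=(\mathsf{swap}_X\hat\otimes\mathrm{id}+\mathrm{id}+\mathsf{swap}_X\hat\otimes\mathrm{id})\circ\mathcal H_{\delta X,X}:\delta(\delta X\hat\otimes X)\to\delta^2X\hat\otimes X+\delta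 X\hat\otimes\delta X+\delta^2X\hat\otimes\delta X=\Sigma^\dagger_{\mathsf{sub}}(X,\delta X)$. $\mathbf{str}^{\mathsf{sub}\dagger}_{X,Y,Z}:\Sigma^\dagger_{\mathsf{sub}}(X,Y)\hat\otimes Z\to\Sigma^\dagger_{\mathsf{sub}}(X,Y\hat\otimes Z)=\delta(Y\hat\otimes Z)\hat\otimes X+\delta X\hat\otimes Y\hat\otimes Z+\delta(Y\hat\otimes Z)\hat\otimes Y\hat\otimes Z$ is, after distributivity: on the first summand $(\mathsf{str}_{Y,Z}\hat\otimes\mathrm{id}_X)\circ(\mathrm{id}\hat\otimes\gamma_{X,Z})$; on the second the identity; on the third $\mathbf{str}^{\mathsf{sub}}_{Y,Z}$. $\sigma^\dagger=[\sigma,\sigma,\sigma]:\Sigma^\dagger_{\mathsf{sub}}(X,X)\to X$. -}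

module Defs where

open import Data.Nat using (ℕ; zero; suc; _+_)
open import Data.Nat.Properties using (+-assoc; +-identityʳ)
open import Data.Fin using (Fin; zero; suc; _↑ˡ_; _↑ʳ_; splitAt; cast)
open import Data.Fin.Properties using (splitAt-↑ˡ; splitAt-↑ʳ; splitAt⁻¹-↑ˡ; splitAt⁻¹-↑ʳ; cast-involutive)
open import Data.Sum using (_⊎_; inj₁; inj₂; [_,_])
open import Data.Sum.Relation.Binary.Pointwise using (Pointwise)
open import Data.Product using (Σ; ∃; _,_; proj₁; proj₂; _×_)
open import Relation.Binary.PropositionalEquality using (_≡_; refl; sym; trans; cong)
open import Relation.Binary using (IsEquivalence)

IsSurj : ∀ {m n} → (Fin m → Fin n) → Set
IsSurj {m} {n} f = ∀ (y : Fin n) → ∃ λ (x : Fin m) → f x ≡ y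

record Surj (m n : ℕ) : Set where
  constructor surj
  field
    fun    : Fin m → Fin n
    isSurj : IsSurj fun
open Surj public

_≈ₛ_ : ∀ {m n} → Surj m n → Surj m n → Set
f ≈ₛ g = ∀ i → fun f i ≡ fun g i

idS : ∀ {n} → Surj n n
idS = surj (λ i → i) (λ y → y , refl)

infixr 9 _∘S_
_∘S_ : ∀ {l m n} → Surj m n → Surj l m → Surj l n
g ∘S f = surj (λ i → fun g (fun f i)) p
  where
  p : IsSurj (λ i → fun g (fun f i))
  p z with isSurj g z
  ... | y , q with isSurj f y
  ...   | x , r = x , trans (cong (fun g) r) q

-- reindexing along an equality of sizes (used for the suppressed associators/unitors)
castS : ∀ {m n} → m ≡ n → Surj m n
castS {m} {n} e = surj (cast e) (λ y → cast (sym e) y , cast-involutive e (sym e) y)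

infixr 7 _⊗S_
_⊗S_ : ∀ {m n m' n'} → Surj m n → Surj m' n' → Surj (m + m') (n + n')
_⊗S_ {m} {n} {m'} {n'} f g = surj h p
  where
  h : Fin (m + m') → Fin (n + n')
  k : Fin m ⊎ Fin m' → Fin (n + n')
  k = [ (λ a → fun f a ↑ˡ n') , (λ b → n ↑ʳ fun g b) ]
  h i = k (splitAt m i)
  p : IsSurj h
  p y with splitAt n y in eq
  ... | inj₁ a with isSurj f a
  ...   | a' , q = a' ↑ˡ m' , trans (cong k (splitAt-↑ˡ m a' m'))
                                  (trans (cong (_↑ˡ n') q) (splitAt⁻¹-↑ˡ eq))
  p y | inj₂ b with isSurj g b
  ...   | b' , q = m ↑ʳ b' , trans (cong k (splitAt-↑ʳ m m' b'))
                                 (trans (cong (n ↑ʳ_) q) (splitAt⁻¹-↑ʳ eq))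

τS : ∀ m n → Surj (m + n) (n + m)
τS m n = surj h p
  where
  h : Fin (m + n) → Fin (n + m)
  k : Fin m ⊎ Fin n → Fin (n + m)
  k = [ (λ a → n ↑ʳ a) , (λ b → b ↑ˡ m) ]
  h i = k (splitAt m i)
  p : IsSurj h
  p y with splitAt n y in eq
  ... | inj₁ b = m ↑ʳ b , trans (cong k (splitAt-↑ʳ m n b)) (splitAt⁻¹-↑ˡ eq)
  ... | inj₂ a = a ↑ˡ n , trans (cong k (splitAt-↑ˡ m a n)) (splitAt⁻¹-↑ʳ eq)

sS : Surj 2 2
sS = τS 1 1

cS : Surj 2 1
cS = surj (λ _ → zero) (λ { zero → zero , refl })

∇S : ∀ n → Surj (n + n) n
∇S n = surj (λ i → [ (λ a → a) , (λ b → b) ] (splitAt n i))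
            (λ y → y ↑ˡ n , cong [ (λ a → a) , (λ b → b) ] (splitAt-↑ˡ n y n))

assocS : ∀ a b c → Surj (a + (b + c)) ((a + b) + c)
assocS a b c = castS (sym (+-assoc a b c))

assocS⁻¹ : ∀ a b c → Surj ((a + b) + c) (a + (b + c))
assocS⁻¹ a b c = castS (+-assoc a b c)

-- θ : 𝐦₁+𝟏+𝐦₂ → 𝐦₁+𝐦₂+𝟏 (fixes 1..m₁, sends m₁+1 to the end, shifts the rest)
θS : ∀ m₁ m₂ → Surj ((m₁ + 1) + m₂) ((m₁ + m₂) + 1)
θS m₁ m₂ = assocS m₁ m₂ 1 ∘S (idS {m₁} ⊗S τS 1 m₂) ∘S assocS⁻¹ m₁ 1 m₂

-- id_n ⊗ s and id_n ⊗ c, on 𝐧+𝟏+𝟏 (= 𝐧+𝟐 up to the suppressed associator)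
swapS : ∀ n → Surj ((n + 1) + 1) ((n + 1) + 1)
swapS n = assocS n 1 1 ∘S (idS {n} ⊗S sS) ∘S assocS⁻¹ n 1 1

contS : ∀ n → Surj ((n + 1) + 1) (n + 1)
contS n = (idS {n} ⊗S cS) ∘S assocS⁻¹ n 1 1

-- Since Agda (without K, no cubical) has no
-- quotient types, each X(𝐧) is a setoid (a type with an equivalence
-- relation); this is needed to represent the coends of Day convolution.

record PSh : Set₁ where
  field
    Ob  : ℕ → Set
    Eq  : ∀ {n} → Ob n → Ob n → Set
    act : ∀ {m n} → Surj m n → Ob m → Ob n
open PSh public

record IsPresheaf (X : PSh) : Set where
  field
    isEquiv  : ∀ n → IsEquivalence (Eq X {n})
    act-cong : ∀ {m n} {f g : Surj m n} {x y : Ob X m} →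
               f ≈ₛ g → Eq X x y → Eq X (act X f x) (act X g y)
    act-id   : ∀ {n} (x : Ob X n) → Eq X (act X idS x) x
    act-∘    : ∀ {l m n} (g : Surj m n) (f : Surj l m) (x : Ob X l) →
               Eq X (act X (g ∘S f) x) (act X g (act X f x))

-- (component families of) maps X → Y; a record so that X, Y are inferable
record Comp (X Y : PSh) : Set where
  constructor comp
  field
    app : ∀ {n} → Ob X n → Ob Y n
open Comp public

_≐_ : ∀ {X Y} → Comp X Y → Comp X Y → Set
_≐_ {X} {Y} f g = ∀ n (x : Ob X n) → Eq Y (app f x) (app g x)

infixr 9 _∙_
_∙_ : ∀ {X Y Z : PSh} → Comp Y Z → Comp X Y → Comp X Z
g ∙ f = comp (λ x → app g (app f x))

idC : ∀ A → Comp A A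
idC A = comp (λ t → t)

record Hom (X Y : PSh) : Set where
  field
    η      : Comp X Y
    η-cong : ∀ {n} {x y : Ob X n} → Eq X x y → Eq Y (app η x) (app η y)
    η-nat  : ∀ {m n} (f : Surj m n) (x : Ob X m) →
             Eq Y (app η (act X f x)) (act Y f (app η x))
open Hom public

record DayEl (X Y : PSh) (n : ℕ) : Set where
  constructor ⟦_,_,_⟧
  field
    {m₁ m₂} : ℕ
    fst : Ob X m₁
    snd : Ob Y m₂
    map : Surj (m₁ + m₂) n

-- the coend relation: equivalence closure of the wedge relations
data DayEq (X Y : PSh) {n : ℕ} : DayEl X Y n → DayEl X Y n → Set where
  d-cong  : ∀ {m₁ m₂} {x x' : Ob X m₁} {y y' : Ob Y m₂} {f f' : Surj (m₁ + m₂) n} →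
            Eq X x x' → Eq Y y y' → f ≈ₛ f' → DayEq X Y ⟦ x , y , f ⟧ ⟦ x' , y' , f' ⟧
  d-left  : ∀ {k m₁ m₂} (g : Surj k m₁) (x : Ob X k) (y : Ob Y m₂) (f : Surj (m₁ + m₂) n) →
            DayEq X Y ⟦ act X g x , y , f ⟧ ⟦ x , y , f ∘S (g ⊗S idS) ⟧
  d-right : ∀ {k m₁ m₂} (g : Surj k m₂) (x : Ob X m₁) (y : Ob Y k) (f : Surj (m₁ + m₂) n) →
            DayEq X Y ⟦ x , act Y g y , f ⟧ ⟦ x , y , f ∘S (idS ⊗S g) ⟧
  d-refl  : ∀ {t} → DayEq X Y t t
  d-sym   : ∀ {t u} → DayEq X Y t u → DayEq X Y u t
  d-trans : ∀ {t u v} → DayEq X Y t u → DayEq X Y u v → DayEq X Y t v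

infixr 7 _⊗̂_
_⊗̂_ : PSh → PSh → PSh
X ⊗̂ Y = record
  { Ob  = DayEl X Y
  ; Eq  = DayEq X Y
  ; act = λ g t → ⟦ DayEl.fst t , DayEl.snd t , g ∘S DayEl.map t ⟧ }

infixr 8 _⊗₁_
_⊗₁_ : ∀ {A B C D} → Comp A C → Comp B D → Comp (A ⊗̂ B) (C ⊗̂ D)
f ⊗₁ g = comp λ { ⟦ a , b , h ⟧ → ⟦ app f a , app g b , h ⟧ }

J : PSh
J = record { Ob = Surj 0 ; Eq = _≈ₛ_ ; act = _∘S_ }

infixr 6 _⊕_
_⊕_ : PSh → PSh → PSh
X ⊕ Y = record
  { Ob  = λ n → Ob X n ⊎ Ob Y n
  ; Eq  = Pointwise (Eq X) (Eq Y)
  ; act = λ f → [ (λ x → inj₁ (act X f x)) , (λ y → inj₂ (act Y f y)) ] }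

⟨_,_⟩ : ∀ {X Y Z} → Comp X Z → Comp Y Z → Comp (X ⊕ Y) Z
⟨ f , g ⟩ = comp [ app f , app g ]

infixr 6 _⊕₁_
_⊕₁_ : ∀ {A B C D} → Comp A C → Comp B D → Comp (A ⊕ B) (C ⊕ D)
f ⊕₁ g = comp [ (λ a → inj₁ (app f a)) , (λ b → inj₂ (app g b)) ]

-- structure maps (on representatives of the coend classes)
λ̂ : ∀ X → Comp (J ⊗̂ X) X
λ̂ X = comp λ { ⟦ j , x , f ⟧ → act X (f ∘S (j ⊗S idS)) x }

r̂ : ∀ X → Comp (X ⊗̂ J) X
r̂ X = comp λ { ⟦ x , j , f ⟧ → act X (f ∘S (idS ⊗S j) ∘S castS (sym (+-identityʳ _))) x }

γ̂ : ∀ X Y → Comp (X ⊗̂ Y) (Y ⊗̂ X)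
γ̂ X Y = comp λ { (⟦_,_,_⟧ {m₁} {m₂} x y f) → ⟦ y , x , f ∘S τS m₂ m₁ ⟧ }

α̂ : ∀ X Y Z → Comp ((X ⊗̂ Y) ⊗̂ Z) (X ⊗̂ (Y ⊗̂ Z))
α̂ X Y Z = comp λ { (⟦_,_,_⟧ {_} {m₃} (⟦_,_,_⟧ {m₁} {m₂} x y f) z g) →
                    ⟦ x , ⟦ y , z , idS ⟧ , g ∘S (f ⊗S idS) ∘S assocS m₁ m₂ m₃ ⟧ }

α̂⁻¹ : ∀ X Y Z → Comp (X ⊗̂ (Y ⊗̂ Z)) ((X ⊗̂ Y) ⊗̂ Z)
α̂⁻¹ X Y Z = comp λ { (⟦_,_,_⟧ {m₁} x (⟦_,_,_⟧ {m₂} {m₃} y z f) g) →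
                      ⟦ ⟦ x , y , idS ⟧ , z , g ∘S (idS ⊗S f) ∘S assocS⁻¹ m₁ m₂ m₃ ⟧ }

dg : ∀ Z → Comp Z (Z ⊗̂ Z)
dg Z = comp λ {n} z → ⟦ z , z , ∇S n ⟧

δ : PSh → PSh
δ X = record
  { Ob  = λ n → Ob X (n + 1)
  ; Eq  = Eq X
  ; act = λ f → act X (f ⊗S idS {1}) }

δ₁ : ∀ {X Y} → Comp X Y → Comp (δ X) (δ Y)
δ₁ f = comp λ {n} x → app f {n + 1} x

swap : ∀ X → Comp (δ (δ X)) (δ (δ X))
swap X = comp λ {n} → act X (swapS n)

cont : ∀ X → Comp (δ (δ X)) (δ X)
cont X = comp λ {n} → act X (contS n)

str' : ∀ X Y → Comp (X ⊗̂ δ Y) (δ (X ⊗̂ Y))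
str' X Y = comp λ { (⟦_,_,_⟧ {m₁} {m₂} x y f) → ⟦ x , y , (f ⊗S idS {1}) ∘S assocS m₁ m₂ 1 ⟧ }

str : ∀ X Y → Comp (δ X ⊗̂ Y) (δ (X ⊗̂ Y))
str X Y = comp λ { (⟦_,_,_⟧ {m₁} {m₂} x y f) → ⟦ x , y , (f ⊗S idS {1}) ∘S θS m₁ m₂ ⟧ }

ρ : ∀ X Y → Comp (δ X ⊗̂ δ Y) (δ (X ⊗̂ Y))
ρ X Y = cont (X ⊗̂ Y) ∙ δ₁ (str' X Y) ∙ str X (δ Y)

-- [str, str', ρ] : δX⊗Y + X⊗δY + δX⊗δY → δ(X⊗Y)   (an isomorphism)
strAll : ∀ X Y → Comp (δ X ⊗̂ Y ⊕ X ⊗̂ δ Y ⊕ δ X ⊗̂ δ Y) (δ (X ⊗̂ Y))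
strAll X Y = ⟨ str X Y , ⟨ str' X Y , ρ X Y ⟩ ⟩

-- H is the inverse of [str,str',ρ] in 𝒮: it respects the setoid equalities and
-- is a two-sided inverse up to them (this determines H up to ≐, and H is natural)
IsInverseH : ∀ X Y → Comp (δ (X ⊗̂ Y)) (δ X ⊗̂ Y ⊕ X ⊗̂ δ Y ⊕ δ X ⊗̂ δ Y) → Set
IsInverseH X Y H =
  (∀ {n} {t u : Ob (δ (X ⊗̂ Y)) n} → Eq (δ (X ⊗̂ Y)) t u →
     Eq (δ X ⊗̂ Y ⊕ X ⊗̂ δ Y ⊕ δ X ⊗̂ δ Y) (app H t) (app H u))
  × ((strAll X Y ∙ H) ≐ idC (δ (X ⊗̂ Y)))
  × ((H ∙ strAll X Y) ≐ idC (δ X ⊗̂ Y ⊕ X ⊗̂ δ Y ⊕ δ X ⊗̂ δ Y))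

-- 𝐬𝐭𝐫^sub_{Y,Z} = (str⊗id)∘(id⊗γ⊗id)∘(id⊗id⊗d_Z) : δY⊗Y⊗Z → δ(Y⊗Z)⊗(Y⊗Z),
-- with the (suppressed) associators made explicit
strSub : ∀ Y Z → Comp ((δ Y ⊗̂ Y) ⊗̂ Z) (δ (Y ⊗̂ Z) ⊗̂ (Y ⊗̂ Z))
strSub Y Z =
    (str Y Z ⊗₁ idC (Y ⊗̂ Z))
  ∙ α̂ (δ Y ⊗̂ Z) Y Z
  ∙ (α̂⁻¹ (δ Y) Z Y ⊗₁ idC Z)
  ∙ ((idC (δ Y) ⊗₁ γ̂ Y Z) ⊗₁ idC Z)
  ∙ (α̂ (δ Y) Y Z ⊗₁ idC Z)
  ∙ α̂⁻¹ (δ Y ⊗̂ Y) Z Z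
  ∙ (idC (δ Y ⊗̂ Y) ⊗₁ dg Z)

Σ† : PSh → PSh → PSh
Σ† X Y = δ Y ⊗̂ X ⊕ δ X ⊗̂ Y ⊕ δ Y ⊗̂ Y

Σ†₁ : ∀ {X X' Y Y'} → Comp X X' → Comp Y Y' → Comp (Σ† X Y) (Σ† X' Y')
Σ†₁ f g = (δ₁ g ⊗₁ f) ⊕₁ (δ₁ f ⊗₁ g) ⊕₁ (δ₁ g ⊗₁ g)

swapSub : ∀ X → Comp (δ (δ X ⊗̂ X)) (δ (δ X) ⊗̂ X ⊕ δ X ⊗̂ δ X ⊕ δ (δ X) ⊗̂ δ X) →
          Comp (δ (δ X ⊗̂ X)) (Σ† X (δ X))
swapSub X H =
  ((swap X ⊗₁ idC X) ⊕₁ idC (δ X ⊗̂ δ X) ⊕₁ (swap X ⊗₁ idC (δ X))) ∙ H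

strSub† : ∀ X Y Z → Comp (Σ† X Y ⊗̂ Z) (Σ† X (Y ⊗̂ Z))
strSub† X Y Z = comp k
  where
  k1 : Comp ((δ Y ⊗̂ X) ⊗̂ Z) (δ (Y ⊗̂ Z) ⊗̂ X)
  k1 = (str Y Z ⊗₁ idC X) ∙ α̂⁻¹ (δ Y) Z X ∙ (idC (δ Y) ⊗₁ γ̂ X Z) ∙ α̂ (δ Y) X Z
  k2 : Comp ((δ X ⊗̂ Y) ⊗̂ Z) (δ X ⊗̂ (Y ⊗̂ Z))
  k2 = α̂ (δ X) Y Z
  k : ∀ {n} → Ob (Σ† X Y ⊗̂ Z) n → Ob (Σ† X (Y ⊗̂ Z)) n
  k ⟦ inj₁ a , z , f ⟧        = inj₁ (app k1 ⟦ a , z , f ⟧)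
  k ⟦ inj₂ (inj₁ b) , z , f ⟧ = inj₂ (inj₁ (app k2 ⟦ b , z , f ⟧))
  k ⟦ inj₂ (inj₂ c) , z , f ⟧ = inj₂ (inj₂ (app (strSub Y Z) ⟦ c , z , f ⟧))

module _ (X : PSh) (σ : Hom (δ X ⊗̂ X) X) (ν : Hom J (δ X)) where

  private
    σ' : Comp (δ X ⊗̂ X) X
    σ' = η σ
    ν' : Comp J (δ X)
    ν' = η ν

  Ax-a : Set
  Ax-a = (σ' ∙ (ν' ⊗₁ idC X)) ≐ λ̂ X

  Ax-b : Set
  Ax-b = (δ₁ σ' ∙ str' (δ X) X ∙ (idC (δ X) ⊗₁ ν')) ≐ r̂ (δ X)

  Ax-c : Set
  Ax-c = (σ' ∙ (idC (δ X) ⊗₁ σ') ∙ α̂ (δ X) (δ X) X)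
         ≐ (σ' ∙ (δ₁ σ' ⊗₁ idC X) ∙ (str' (δ X) X ⊗₁ idC X))

  Ax-d : Set
  Ax-d = (σ' ∙ (δ₁ σ' ⊗₁ idC X) ∙ (str (δ X) X ⊗₁ idC X))
         ≐ (σ' ∙ (δ₁ σ' ⊗₁ idC X) ∙ (str (δ X) X ⊗₁ idC X)
               ∙ α̂⁻¹ (δ (δ X)) X X ∙ (idC (δ (δ X)) ⊗₁ γ̂ X X)
               ∙ (swap X ⊗₁ idC (X ⊗̂ X)) ∙ α̂ (δ (δ X)) X X)

  Ax-f : Set
  Ax-f = (σ' ∙ (δ₁ σ' ⊗₁ idC X) ∙ (ρ (δ X) X ⊗₁ idC X))
         ≐ (σ' ∙ (δ₁ σ' ⊗₁ σ') ∙ strSub (δ X) X ∙ ((swap X ⊗₁ idC (δ X)) ⊗₁ idC X))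

  IsRelevantSubstitutionAlgebra : Set
  IsRelevantSubstitutionAlgebra = Ax-a × Ax-b × Ax-c × Ax-d × Ax-f

  σ† : Comp (Σ† X X) X
  σ† = ⟨ σ' , ⟨ σ' , σ' ⟩ ⟩

  ExtSubst : Comp (δ (δ X ⊗̂ X)) (δ (δ X) ⊗̂ X ⊕ δ X ⊗̂ δ X ⊕ δ (δ X) ⊗̂ δ X) → Set
  ExtSubst H = (σ' ∙ (δ₁ σ' ⊗₁ idC X))
               ≐ (σ† ∙ Σ†₁ (idC X) σ' ∙ strSub† X (δ X) X ∙ (swapSub X H ⊗₁ idC X))

{-# OPTIONS --safe #-}
module Submission where

-- Since [str, str′, ρ] : δ²X ⊗ X + δX ⊗ δX + δ²X ⊗ δX → δ(δX ⊗ X) is invertible with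
-- inverse H, an equation between maps out of δ(δX ⊗ X) ⊗ X holds iff it holds after
-- precomposition with [str, str′, ρ] ⊗ id, that is, on each of the three summands. There the
-- extended substitution lemma is literally (d), (c) with its sides exchanged, and (f); the
-- swaps in 𝐬𝐰𝐚𝐩^sub are those of (d) and (f). Transporting along H needs the right-hand side
-- to respect the coend relation of Day convolution, which reduces to the naturality in 𝕊 of
-- the associator, symmetry, strength, diagonal and swap on the underlying surjections.

open import Defs
open import Data.Fin using (Fin; zero; _↑ˡ_; _↑ʳ_; splitAt; toℕ)
open import Data.Fin.Properties
  using (splitAt-↑ˡ; splitAt-↑ʳ; join-splitAt; toℕ-injective; toℕ-↑ˡ; toℕ-↑ʳ; toℕ-cast; cast-involutive)
open import Data.Nat using (ℕ; _+_)
open import Data.Nat.Properties using (+-assoc)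
open import Data.Product using (_×_; _,_)
open import Data.Product.Function.NonDependent.Propositional using (_×-⇔_)
open import Data.Sum using (inj₁; inj₂)
open import Data.Sum.Relation.Binary.Pointwise using (inj₁; inj₂)
open import Function using (_∘_)
open import Function.Bundles using (_⇔_; mk⇔)
open import Function.Properties.Equivalence using () renaming (refl to ⇔-refl; trans to ⇔-trans)
open import Level using (0ℓ)
open import Relation.Binary using (Setoid; IsEquivalence; Reflexive; _Preserves_⟶_)
open import Relation.Binary.PropositionalEquality
  using (_≡_; refl; sym; trans; cong; _→-setoid_; module ≡-Reasoning)
import Relation.Binary.Reasoning.Setoid as SetoidReasoning

data SplitView (m n : ℕ) : Fin (m + n) → Set where
  left  : (a : Fin m) → SplitView m n (a ↑ˡ n)
  right : (b : Fin n) → SplitView m n (m ↑ʳ b)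

splitView : ∀ m n (i : Fin (m + n)) → SplitView m n i
splitView m n i with splitAt m i | join-splitAt m n i
... | inj₁ a | refl = left a
... | inj₂ b | refl = right b

module _ {m n m′ n′} (f : Surj m n) (g : Surj m′ n′) where

  ⊗S-↑ˡ : ∀ a → fun (f ⊗S g) (a ↑ˡ m′) ≡ fun f a ↑ˡ n′
  ⊗S-↑ˡ a rewrite splitAt-↑ˡ m a m′ = refl

  ⊗S-↑ʳ : ∀ b → fun (f ⊗S g) (m ↑ʳ b) ≡ n ↑ʳ fun g b
  ⊗S-↑ʳ b rewrite splitAt-↑ʳ m m′ b = refl

module _ (m n : ℕ) where

  τS-↑ˡ : ∀ a → fun (τS m n) (a ↑ˡ n) ≡ n ↑ʳ a
  τS-↑ˡ a rewrite splitAt-↑ˡ m a n = refl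

  τS-↑ʳ : ∀ b → fun (τS m n) (m ↑ʳ b) ≡ b ↑ˡ m
  τS-↑ʳ b rewrite splitAt-↑ʳ m n b = refl

module _ (n : ℕ) where

  ∇S-↑ˡ : ∀ a → fun (∇S n) (a ↑ˡ n) ≡ a
  ∇S-↑ˡ a rewrite splitAt-↑ˡ n a n = refl

  ∇S-↑ʳ : ∀ b → fun (∇S n) (n ↑ʳ b) ≡ b
  ∇S-↑ʳ b rewrite splitAt-↑ʳ n n b = refl

module _ (a b c : ℕ) where

  private
    assocS-toℕ : ∀ {i j} → toℕ i ≡ toℕ j → fun (assocS a b c) i ≡ j
    assocS-toℕ {i} p = toℕ-injective (trans (toℕ-cast _ i) p)

  assocS⁻¹-assocS : ∀ i → fun (assocS⁻¹ a b c) (fun (assocS a b c) i) ≡ i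
  assocS⁻¹-assocS = cast-involutive (+-assoc a b c) (sym (+-assoc a b c))

  assocS-assocS⁻¹ : ∀ i → fun (assocS a b c) (fun (assocS⁻¹ a b c) i) ≡ i
  assocS-assocS⁻¹ = cast-involutive (sym (+-assoc a b c)) (+-assoc a b c)

  assocS-↑ˡ : ∀ x → fun (assocS a b c) (x ↑ˡ (b + c)) ≡ (x ↑ˡ b) ↑ˡ c
  assocS-↑ˡ x = assocS-toℕ (begin
    toℕ (x ↑ˡ (b + c))  ≡⟨ toℕ-↑ˡ x (b + c) ⟩
    toℕ x               ≡⟨ toℕ-↑ˡ x b ⟨
    toℕ (x ↑ˡ b)        ≡⟨ toℕ-↑ˡ (x ↑ˡ b) c ⟨
    toℕ ((x ↑ˡ b) ↑ˡ c) ∎)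
    where open ≡-Reasoning

  assocS-↑ʳ↑ˡ : ∀ y → fun (assocS a b c) (a ↑ʳ (y ↑ˡ c)) ≡ (a ↑ʳ y) ↑ˡ c
  assocS-↑ʳ↑ˡ y = assocS-toℕ (begin
    toℕ (a ↑ʳ (y ↑ˡ c))  ≡⟨ toℕ-↑ʳ a (y ↑ˡ c) ⟩
    a + toℕ (y ↑ˡ c)     ≡⟨ cong (a +_) (toℕ-↑ˡ y c) ⟩
    a + toℕ y            ≡⟨ toℕ-↑ʳ a y ⟨
    toℕ (a ↑ʳ y)         ≡⟨ toℕ-↑ˡ (a ↑ʳ y) c ⟨
    toℕ ((a ↑ʳ y) ↑ˡ c)  ∎)
    where open ≡-Reasoning

  assocS-↑ʳ↑ʳ : ∀ z → fun (assocS a b c) (a ↑ʳ (b ↑ʳ z)) ≡ (a + b) ↑ʳ z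
  assocS-↑ʳ↑ʳ z = assocS-toℕ (begin
    toℕ (a ↑ʳ (b ↑ʳ z))  ≡⟨ toℕ-↑ʳ a (b ↑ʳ z) ⟩
    a + toℕ (b ↑ʳ z)     ≡⟨ cong (a +_) (toℕ-↑ʳ b z) ⟩
    a + (b + toℕ z)      ≡⟨ +-assoc a b (toℕ z) ⟨
    a + b + toℕ z        ≡⟨ toℕ-↑ʳ (a + b) z ⟨
    toℕ ((a + b) ↑ʳ z)   ∎)
    where open ≡-Reasoning

  private
    assocS⁻¹-inverts : ∀ {i j} → fun (assocS a b c) i ≡ j → fun (assocS⁻¹ a b c) j ≡ i
    assocS⁻¹-inverts {i} refl = assocS⁻¹-assocS i

  assocS⁻¹-↑ˡ↑ˡ : ∀ x → fun (assocS⁻¹ a b c) ((x ↑ˡ b) ↑ˡ c) ≡ x ↑ˡ (b + c)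
  assocS⁻¹-↑ˡ↑ˡ x = assocS⁻¹-inverts (assocS-↑ˡ x)

  assocS⁻¹-↑ʳ↑ˡ : ∀ y → fun (assocS⁻¹ a b c) ((a ↑ʳ y) ↑ˡ c) ≡ a ↑ʳ (y ↑ˡ c)
  assocS⁻¹-↑ʳ↑ˡ y = assocS⁻¹-inverts (assocS-↑ʳ↑ˡ y)

  assocS⁻¹-↑ʳ : ∀ z → fun (assocS⁻¹ a b c) ((a + b) ↑ʳ z) ≡ a ↑ʳ (b ↑ʳ z)
  assocS⁻¹-↑ʳ z = assocS⁻¹-inverts (assocS-↑ʳ↑ʳ z)

∘S-chase : ∀ {a b c d} (h : Surj c d) (g : Surj b c) (f : Surj a b) {i j k l} →
         fun f i ≡ j → fun g j ≡ k → fun h k ≡ l → fun (h ∘S g ∘S f) i ≡ l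
∘S-chase h g f refl refl refl = refl

module _ (m₁ m₂ : ℕ) where

  private
    θS-chase : ∀ {i j k l} → fun (assocS⁻¹ m₁ 1 m₂) i ≡ j → fun (idS {m₁} ⊗S τS 1 m₂) j ≡ k →
               fun (assocS m₁ m₂ 1) k ≡ l → fun (θS m₁ m₂) i ≡ l
    θS-chase = ∘S-chase (assocS m₁ m₂ 1) (idS ⊗S τS 1 m₂) (assocS⁻¹ m₁ 1 m₂)

  θS-↑ˡ↑ˡ : ∀ x → fun (θS m₁ m₂) ((x ↑ˡ 1) ↑ˡ m₂) ≡ (x ↑ˡ m₂) ↑ˡ 1
  θS-↑ˡ↑ˡ x = θS-chase (assocS⁻¹-↑ˡ↑ˡ m₁ 1 m₂ x) (⊗S-↑ˡ idS (τS 1 m₂) x)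
                       (assocS-↑ˡ m₁ m₂ 1 x)

  θS-↑ʳ↑ˡ : fun (θS m₁ m₂) ((m₁ ↑ʳ zero) ↑ˡ m₂) ≡ (m₁ + m₂) ↑ʳ zero
  θS-↑ʳ↑ˡ = θS-chase (assocS⁻¹-↑ʳ↑ˡ m₁ 1 m₂ zero)
                     (trans (⊗S-↑ʳ (idS {m₁}) (τS 1 m₂) _) (cong (m₁ ↑ʳ_) (τS-↑ˡ 1 m₂ zero)))
                     (assocS-↑ʳ↑ʳ m₁ m₂ 1 zero)

  θS-↑ʳ : ∀ y → fun (θS m₁ m₂) ((m₁ + 1) ↑ʳ y) ≡ (m₁ ↑ʳ y) ↑ˡ 1
  θS-↑ʳ y = θS-chase (assocS⁻¹-↑ʳ m₁ 1 m₂ y)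
                     (trans (⊗S-↑ʳ (idS {m₁}) (τS 1 m₂) _) (cong (m₁ ↑ʳ_) (τS-↑ʳ 1 m₂ y)))
                     (assocS-↑ʳ↑ˡ m₁ m₂ 1 y)

module _ (n : ℕ) where

  private
    swapS-chase : ∀ {i j k l} → fun (assocS⁻¹ n 1 1) i ≡ j → fun (idS {n} ⊗S sS) j ≡ k →
                  fun (assocS n 1 1) k ≡ l → fun (swapS n) i ≡ l
    swapS-chase = ∘S-chase (assocS n 1 1) (idS ⊗S sS) (assocS⁻¹ n 1 1)

  swapS-↑ˡ↑ˡ : ∀ x → fun (swapS n) ((x ↑ˡ 1) ↑ˡ 1) ≡ (x ↑ˡ 1) ↑ˡ 1
  swapS-↑ˡ↑ˡ x = swapS-chase (assocS⁻¹-↑ˡ↑ˡ n 1 1 x) (⊗S-↑ˡ idS sS x) (assocS-↑ˡ n 1 1 x)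

  swapS-↑ʳ↑ˡ : fun (swapS n) ((n ↑ʳ zero) ↑ˡ 1) ≡ (n + 1) ↑ʳ zero
  swapS-↑ʳ↑ˡ = swapS-chase (assocS⁻¹-↑ʳ↑ˡ n 1 1 zero)
                           (trans (⊗S-↑ʳ (idS {n}) sS _) (cong (n ↑ʳ_) (τS-↑ˡ 1 1 zero)))
                           (assocS-↑ʳ↑ʳ n 1 1 zero)

  swapS-↑ʳ : fun (swapS n) ((n + 1) ↑ʳ zero) ≡ (n ↑ʳ zero) ↑ˡ 1
  swapS-↑ʳ = swapS-chase (assocS⁻¹-↑ʳ n 1 1 zero)
                         (trans (⊗S-↑ʳ (idS {n}) sS _) (cong (n ↑ʳ_) (τS-↑ʳ 1 1 zero)))
                         (assocS-↑ʳ↑ˡ n 1 1 zero)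

-- The surjections are explicit: Agda cannot recover them from the pointwise type f ≈ₛ f′.
⊗S-cong : ∀ {m n m′ n′} (f f′ : Surj m n) (g g′ : Surj m′ n′) →
          f ≈ₛ f′ → g ≈ₛ g′ → (f ⊗S g) ≈ₛ (f′ ⊗S g′)
⊗S-cong {m} {m′ = m′} f f′ g g′ p q i with splitView m m′ i
... | left a  rewrite ⊗S-↑ˡ f g a | ⊗S-↑ˡ f′ g′ a | p a = refl
... | right b rewrite ⊗S-↑ʳ f g b | ⊗S-↑ʳ f′ g′ b | q b = refl

⊗S-∘S : ∀ {a b c a′ b′ c′} (g : Surj b c) (f : Surj a b) (g′ : Surj b′ c′) (f′ : Surj a′ b′) →
        ((g ∘S f) ⊗S (g′ ∘S f′)) ≈ₛ ((g ⊗S g′) ∘S (f ⊗S f′))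
⊗S-∘S {a} {a′ = a′} g f g′ f′ i with splitView a a′ i
... | left x  rewrite ⊗S-↑ˡ (g ∘S f) (g′ ∘S f′) x | ⊗S-↑ˡ f f′ x | ⊗S-↑ˡ g g′ (fun f x) = refl
... | right y rewrite ⊗S-↑ʳ (g ∘S f) (g′ ∘S f′) y | ⊗S-↑ʳ f f′ y | ⊗S-↑ʳ g g′ (fun f′ y) = refl

idS⊗S-idS : ∀ m n → (idS {m} ⊗S idS {n}) ≈ₛ idS
idS⊗S-idS m n i with splitView m n i
... | left a  = ⊗S-↑ˡ idS idS a
... | right b = ⊗S-↑ʳ idS idS b

τS-natural : ∀ {m n m′ n′} (f : Surj m′ m) (g : Surj n′ n) →
             (τS m n ∘S (f ⊗S g)) ≈ₛ ((g ⊗S f) ∘S τS m′ n′)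
τS-natural {m} {n} {m′} {n′} f g i with splitView m′ n′ i
... | left a  rewrite ⊗S-↑ˡ f g a | τS-↑ˡ m n (fun f a) | τS-↑ˡ m′ n′ a | ⊗S-↑ʳ g f a = refl
... | right b rewrite ⊗S-↑ʳ f g b | τS-↑ʳ m n (fun g b) | τS-↑ʳ m′ n′ b | ⊗S-↑ˡ g f b = refl

∇S-natural : ∀ {m n} (g : Surj m n) → (∇S n ∘S (g ⊗S idS) ∘S (idS ⊗S g)) ≈ₛ (g ∘S ∇S m)
∇S-natural {m} {n} g i with splitView m m i
... | left a
  rewrite ⊗S-↑ˡ (idS {m}) g a | ⊗S-↑ˡ g (idS {n}) a | ∇S-↑ˡ n (fun g a) | ∇S-↑ˡ m a = refl
... | right b
  rewrite ⊗S-↑ʳ (idS {m}) g b | ⊗S-↑ʳ g (idS {n}) (fun g b) | ∇S-↑ʳ n (fun g b) | ∇S-↑ʳ m b = refl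

assocS-natural : ∀ {a b c a′ b′ c′} (f : Surj a a′) (g : Surj b b′) (h : Surj c c′) →
                 (assocS a′ b′ c′ ∘S (f ⊗S (g ⊗S h))) ≈ₛ (((f ⊗S g) ⊗S h) ∘S assocS a b c)
assocS-natural {a} {b} {c} {a′} {b′} {c′} f g h i with splitView a (b + c) i
... | left x
  rewrite ⊗S-↑ˡ f (g ⊗S h) x | assocS-↑ˡ a′ b′ c′ (fun f x)
        | assocS-↑ˡ a b c x | ⊗S-↑ˡ (f ⊗S g) h (x ↑ˡ b) | ⊗S-↑ˡ f g x = refl
... | right j with splitView b c j
...   | left y
  rewrite ⊗S-↑ʳ f (g ⊗S h) (y ↑ˡ c) | ⊗S-↑ˡ g h y | assocS-↑ʳ↑ˡ a′ b′ c′ (fun g y)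
        | assocS-↑ʳ↑ˡ a b c y | ⊗S-↑ˡ (f ⊗S g) h (a ↑ʳ y) | ⊗S-↑ʳ f g y = refl
...   | right z
  rewrite ⊗S-↑ʳ f (g ⊗S h) (b ↑ʳ z) | ⊗S-↑ʳ g h z | assocS-↑ʳ↑ʳ a′ b′ c′ (fun h z)
        | assocS-↑ʳ↑ʳ a b c z | ⊗S-↑ʳ (f ⊗S g) h z = refl

assocS⁻¹-natural : ∀ {a b c a′ b′ c′} (f : Surj a a′) (g : Surj b b′) (h : Surj c c′) →
                   (assocS⁻¹ a′ b′ c′ ∘S ((f ⊗S g) ⊗S h)) ≈ₛ ((f ⊗S (g ⊗S h)) ∘S assocS⁻¹ a b c)
assocS⁻¹-natural {a} {b} {c} {a′} {b′} {c′} f g h i = begin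
  fun (assocS⁻¹ a′ b′ c′) (fun ((f ⊗S g) ⊗S h) i)
    ≡⟨ cong (fun (assocS⁻¹ a′ b′ c′) ∘ fun ((f ⊗S g) ⊗S h)) (assocS-assocS⁻¹ a b c i) ⟨
  fun (assocS⁻¹ a′ b′ c′) (fun ((f ⊗S g) ⊗S h) (fun (assocS a b c) j))
    ≡⟨ cong (fun (assocS⁻¹ a′ b′ c′)) (assocS-natural f g h j) ⟨
  fun (assocS⁻¹ a′ b′ c′) (fun (assocS a′ b′ c′) (fun (f ⊗S (g ⊗S h)) j))
    ≡⟨ assocS⁻¹-assocS a′ b′ c′ _ ⟩
  fun (f ⊗S (g ⊗S h)) j ∎
  where
  open ≡-Reasoning
  j : Fin (a + (b + c))
  j = fun (assocS⁻¹ a b c) i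

θS-natural : ∀ {p q m₁ m₂} (k : Surj p m₁) (g : Surj q m₂) →
             (θS m₁ m₂ ∘S ((k ⊗S idS {1}) ⊗S g)) ≈ₛ (((k ⊗S g) ⊗S idS {1}) ∘S θS p q)
θS-natural {p} {q} {m₁} {m₂} k g i with splitView (p + 1) q i
... | left j with splitView p 1 j
...   | left x
  rewrite θS-↑ˡ↑ˡ p q x | ⊗S-↑ˡ (k ⊗S g) (idS {1}) (x ↑ˡ q) | ⊗S-↑ˡ k g x
        | ⊗S-↑ˡ (k ⊗S idS {1}) g (x ↑ˡ 1) | ⊗S-↑ˡ k (idS {1}) x | θS-↑ˡ↑ˡ m₁ m₂ (fun k x) = refl
...   | right zero
  rewrite θS-↑ʳ↑ˡ p q | ⊗S-↑ʳ (k ⊗S g) (idS {1}) zero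
        | ⊗S-↑ˡ (k ⊗S idS {1}) g (p ↑ʳ zero) | ⊗S-↑ʳ k (idS {1}) zero | θS-↑ʳ↑ˡ m₁ m₂ = refl
θS-natural {p} {q} {m₁} {m₂} k g i | right y
  rewrite θS-↑ʳ p q y | ⊗S-↑ˡ (k ⊗S g) (idS {1}) (p ↑ʳ y) | ⊗S-↑ʳ k g y
        | ⊗S-↑ʳ (k ⊗S idS {1}) g y | θS-↑ʳ m₁ m₂ (fun g y) = refl

swapS-natural : ∀ {m n} (f : Surj m n) →
                (swapS n ∘S ((f ⊗S idS {1}) ⊗S idS {1})) ≈ₛ (((f ⊗S idS {1}) ⊗S idS {1}) ∘S swapS m)
swapS-natural {m} {n} f i with splitView (m + 1) 1 i
... | left j with splitView m 1 j
...   | left x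
  rewrite swapS-↑ˡ↑ˡ m x | ⊗S-↑ˡ (f ⊗S idS {1}) (idS {1}) (x ↑ˡ 1) | ⊗S-↑ˡ f (idS {1}) x
        | swapS-↑ˡ↑ˡ n (fun f x) = refl
...   | right zero
  rewrite swapS-↑ʳ↑ˡ m | ⊗S-↑ʳ (f ⊗S idS {1}) (idS {1}) zero
        | ⊗S-↑ˡ (f ⊗S idS {1}) (idS {1}) (m ↑ʳ zero) | ⊗S-↑ʳ f (idS {1}) zero | swapS-↑ʳ↑ˡ n = refl
swapS-natural {m} {n} f i | right zero
  rewrite swapS-↑ʳ m | ⊗S-↑ˡ (f ⊗S idS {1}) (idS {1}) (m ↑ʳ zero) | ⊗S-↑ʳ f (idS {1}) zero
        | ⊗S-↑ʳ (f ⊗S idS {1}) (idS {1}) zero | swapS-↑ʳ n = refl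

EqReflexive : PSh → Set
EqReflexive A = ∀ {n} → Reflexive (Eq A {n})

PreservesEq : ∀ {A B} → Comp A B → Set
PreservesEq {A} {B} f = ∀ {n} → app f Preserves Eq A {n} ⟶ Eq B

PreservesEqˡ : ∀ {A Z B} → Comp (A ⊗̂ Z) B → Set
PreservesEqˡ {A} {Z} {B} f = ∀ {m₁ m₂ n} (z : Ob Z m₂) (h : Surj (m₁ + m₂) n) →
                             (λ a → app f ⟦ a , z , h ⟧) Preserves Eq A ⟶ Eq B

DaySetoid : PSh → PSh → ℕ → Setoid 0ℓ 0ℓ
DaySetoid A B n = record
  { Carrier       = DayEl A B n
  ; _≈_           = DayEq A B
  ; isEquivalence = record { refl = d-refl ; sym = d-sym ; trans = d-trans }
  }

module _ {A B : PSh} {n : ℕ} (S : Setoid 0ℓ 0ℓ) (F : DayEl A B n → Setoid.Carrier S) where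
  open Setoid S using (_≈_) renaming (refl to ≈-refl; sym to ≈-sym; trans to ≈-trans)

  preserves-DayEq :
    (∀ {m₁ m₂} {x x′ : Ob A m₁} {y y′ : Ob B m₂} {h h′ : Surj (m₁ + m₂) n} →
       Eq A x x′ → Eq B y y′ → h ≈ₛ h′ → F ⟦ x , y , h ⟧ ≈ F ⟦ x′ , y′ , h′ ⟧) →
    (∀ {k m₁ m₂} (g : Surj k m₁) (x : Ob A k) (y : Ob B m₂) (h : Surj (m₁ + m₂) n) →
       F ⟦ act A g x , y , h ⟧ ≈ F ⟦ x , y , h ∘S (g ⊗S idS) ⟧) →
    (∀ {k m₁ m₂} (g : Surj k m₂) (x : Ob A m₁) (y : Ob B k) (h : Surj (m₁ + m₂) n) →
       F ⟦ x , act B g y , h ⟧ ≈ F ⟦ x , y , h ∘S (idS ⊗S g) ⟧) →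
    F Preserves DayEq A B ⟶ _≈_
  preserves-DayEq on-cong on-left on-right = go
    where
    go : F Preserves DayEq A B ⟶ _≈_
    go (d-cong p q r)    = on-cong p q r
    go (d-left g x y h)  = on-left g x y h
    go (d-right g x y h) = on-right g x y h
    go d-refl            = ≈-refl
    go (d-sym e)         = ≈-sym (go e)
    go (d-trans e e′)    = ≈-trans (go e) (go e′)

d-congˡ : ∀ {A B m₁ m₂ n} {x x′ : Ob A m₁} {y : Ob B m₂} {h : Surj (m₁ + m₂) n} →
          EqReflexive B → Eq A x x′ → DayEq A B ⟦ x , y , h ⟧ ⟦ x′ , y , h ⟧
d-congˡ reflB p = d-cong p reflB (λ _ → refl)

d-congʳ : ∀ {A B m₁ m₂ n} {x : Ob A m₁} {y y′ : Ob B m₂} {h : Surj (m₁ + m₂) n} →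
          EqReflexive A → Eq B y y′ → DayEq A B ⟦ x , y , h ⟧ ⟦ x , y′ , h ⟧
d-congʳ reflA q = d-cong reflA q (λ _ → refl)

-- In pair-actˡ and pair-actʳ the last step only changes the surjectivity witness of the map.
module _ {A B : PSh} (reflA : EqReflexive A) (reflB : EqReflexive B) where

  pair-actˡ : ∀ {k m₁ m₂} (g : Surj k m₁) (x : Ob A k) (y : Ob B m₂) →
              DayEq A B ⟦ act A g x , y , idS ⟧ (act (A ⊗̂ B) (g ⊗S idS) ⟦ x , y , idS ⟧)
  pair-actˡ g x y = d-trans (d-left g x y idS) (d-cong reflA reflB (λ _ → refl))

  pair-actʳ : ∀ {k m₁ m₂} (g : Surj k m₂) (x : Ob A m₁) (y : Ob B k) →
              DayEq A B ⟦ x , act B g y , idS ⟧ (act (A ⊗̂ B) (idS ⊗S g) ⟦ x , y , idS ⟧)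
  pair-actʳ g x y = d-trans (d-right g x y idS) (d-cong reflA reflB (λ _ → refl))

id-hom : ∀ A → EqReflexive A → Hom A A
id-hom A reflA = record { η = idC A ; η-cong = λ p → p ; η-nat = λ _ _ → reflA }

δ-hom : ∀ {A B} → Hom A B → Hom (δ A) (δ B)
δ-hom f = record { η = δ₁ (η f) ; η-cong = η-cong f ; η-nat = λ g → η-nat f (g ⊗S idS) }

⊗-hom : ∀ {A B C D} → Hom A C → Hom B D → EqReflexive C → EqReflexive D → Hom (A ⊗̂ B) (C ⊗̂ D)
⊗-hom {C = C} {D} f g reflC reflD = record
  { η      = η f ⊗₁ η g
  ; η-cong = preserves-DayEq (DaySetoid C D _) (app (η f ⊗₁ η g))
      (λ p q r → d-cong (η-cong f p) (η-cong g q) r)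
      (λ k x y h → d-trans (d-congˡ reflD (η-nat f k x)) (d-left k _ _ h))
      (λ k x y h → d-trans (d-congʳ reflC (η-nat g k y)) (d-right k _ _ h))
  ; η-nat  = λ _ _ → d-refl
  }

dg-hom : ∀ Z → EqReflexive Z → Hom Z (Z ⊗̂ Z)
dg-hom Z reflZ = record
  { η      = dg Z
  ; η-cong = λ p → d-cong p p (λ _ → refl)
  ; η-nat  = λ g z → d-trans (d-left g z (act Z g z) _)
                       (d-trans (d-right g z z _) (d-cong reflZ reflZ (∇S-natural g)))
  }

module _ (X Y : PSh) (reflX : EqReflexive X) (reflY : EqReflexive Y) where

  γ̂-hom : Hom (X ⊗̂ Y) (Y ⊗̂ X)
  γ̂-hom = record
    { η      = γ̂ X Y
    ; η-cong = preserves-DayEq (DaySetoid Y X _) (app (γ̂ X Y))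
        (λ p q r → d-cong q p (r ∘ _))
        (λ k x y h → d-trans (d-right k y x _) (d-cong reflY reflX (cong (fun h) ∘ τS-natural idS k)))
        (λ k x y h → d-trans (d-left k y x _) (d-cong reflY reflX (cong (fun h) ∘ τS-natural k idS)))
    ; η-nat  = λ _ _ → d-cong reflY reflX (λ _ → refl)
    }

  str-hom : Hom (δ X ⊗̂ Y) (δ (X ⊗̂ Y))
  str-hom = record
    { η      = str X Y
    ; η-cong = preserves-DayEq (DaySetoid X Y _) (app (str X Y))
        (λ {h = h} {h′} p q r → d-cong p q (⊗S-cong h h′ idS idS r (λ _ → refl) ∘ _))
        (λ k x y h → d-trans (d-left (k ⊗S idS) x y _) (d-cong reflX reflY (absorb-left k h)))
        (λ k x y h → d-trans (d-right k x y _) (d-cong reflX reflY (absorb-right k h)))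
    ; η-nat  = λ g t → d-cong reflX reflY (⊗S-∘S g (DayEl.map t) idS idS ∘ _)
    }
    where
    absorb-left : ∀ {p m₁ m₂ n} (k : Surj p m₁) (h : Surj (m₁ + m₂) n) →
                  ((h ⊗S idS) ∘S θS m₁ m₂ ∘S ((k ⊗S idS) ⊗S idS))
                    ≈ₛ (((h ∘S (k ⊗S idS)) ⊗S idS) ∘S θS p m₂)
    absorb-left {p} {m₁} {m₂} {n} k h = begin
      fun ((h ⊗S idS) ∘S θS m₁ m₂ ∘S ((k ⊗S idS) ⊗S idS))
        ≈⟨ cong (fun (h ⊗S idS)) ∘ θS-natural k (idS {m₂}) ⟩
      fun ((h ⊗S idS) ∘S ((k ⊗S idS) ⊗S idS) ∘S θS p m₂)
        ≈⟨ ⊗S-∘S h (k ⊗S idS) idS idS ∘ fun (θS p m₂) ⟨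
      fun (((h ∘S (k ⊗S idS)) ⊗S idS) ∘S θS p m₂)
        ∎
      where open SetoidReasoning (Fin ((p + 1) + m₂) →-setoid Fin (n + 1))

    absorb-right : ∀ {q m₁ m₂ n} (k : Surj q m₂) (h : Surj (m₁ + m₂) n) →
                   ((h ⊗S idS) ∘S θS m₁ m₂ ∘S (idS ⊗S k))
                     ≈ₛ (((h ∘S (idS ⊗S k)) ⊗S idS) ∘S θS m₁ q)
    absorb-right {q} {m₁} {m₂} {n} k h = begin
      fun ((h ⊗S idS) ∘S θS m₁ m₂ ∘S (idS ⊗S k))
        ≈⟨ cong (fun ((h ⊗S idS) ∘S θS m₁ m₂))
             ∘ ⊗S-cong idS (idS {m₁} ⊗S idS {1}) k k (sym ∘ idS⊗S-idS m₁ 1) (λ _ → refl) ⟩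
      fun ((h ⊗S idS) ∘S θS m₁ m₂ ∘S ((idS {m₁} ⊗S idS {1}) ⊗S k))
        ≈⟨ cong (fun (h ⊗S idS)) ∘ θS-natural (idS {m₁}) k ⟩
      fun ((h ⊗S idS {1}) ∘S ((idS {m₁} ⊗S k) ⊗S idS) ∘S θS m₁ q)
        ≈⟨ ⊗S-∘S h (idS ⊗S k) idS idS ∘ fun (θS m₁ q) ⟨
      fun (((h ∘S (idS ⊗S k)) ⊗S idS) ∘S θS m₁ q)
        ∎
      where open SetoidReasoning (Fin ((m₁ + 1) + q) →-setoid Fin (n + 1))

module _ (X Y Z : PSh) (reflX : EqReflexive X) (reflY : EqReflexive Y) (reflZ : EqReflexive Z) where

  α̂-hom : Hom ((X ⊗̂ Y) ⊗̂ Z) (X ⊗̂ (Y ⊗̂ Z))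
  α̂-hom = record
    { η      = α̂ X Y Z
    ; η-cong = preserves-DayEq (DaySetoid X (Y ⊗̂ Z) _) (app (α̂ X Y Z))
        (λ {y = z} {h = g} p q r →
           d-trans (in-first-factor z g p) (d-cong reflX (d-congʳ reflY q) (r ∘ _)))
        (λ { k ⟦ x , y , f ⟧ z g → d-cong reflX d-refl (cong (fun g) ∘ (⊗S-∘S k f idS idS ∘ _)) })
        (λ { k (⟦_,_,_⟧ {m₁} {m₂} x y f) z g →
           d-trans (d-congʳ reflX (pair-actʳ reflY reflZ k y z))
                   (d-trans (d-right (idS ⊗S k) x ⟦ y , z , idS ⟧ _)
                            (d-cong reflX d-refl (cong (fun g) ∘ absorb-third {m₁ = m₁} {m₂} k f))) })
    ; η-nat  = λ _ _ → d-cong reflX d-refl (λ _ → refl)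
    }
    where
    absorb-first : ∀ {p m₁ m₂ m₃ n} (k : Surj p m₁) (f : Surj (m₁ + m₂) n) →
                   ((f ⊗S idS) ∘S assocS m₁ m₂ m₃ ∘S (k ⊗S idS))
                     ≈ₛ (((f ∘S (k ⊗S idS)) ⊗S idS) ∘S assocS p m₂ m₃)
    absorb-first {p} {m₁} {m₂} {m₃} {n} k f = begin
      fun ((f ⊗S idS) ∘S assocS m₁ m₂ m₃ ∘S (k ⊗S idS {m₂ + m₃}))
        ≈⟨ cong (fun ((f ⊗S idS) ∘S assocS m₁ m₂ m₃))
             ∘ ⊗S-cong k k idS (idS {m₂} ⊗S idS {m₃}) (λ _ → refl) (sym ∘ idS⊗S-idS m₂ m₃) ⟩
      fun ((f ⊗S idS) ∘S assocS m₁ m₂ m₃ ∘S (k ⊗S (idS {m₂} ⊗S idS {m₃})))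
        ≈⟨ cong (fun (f ⊗S idS)) ∘ assocS-natural k (idS {m₂}) (idS {m₃}) ⟩
      fun ((f ⊗S idS {m₃}) ∘S ((k ⊗S idS) ⊗S idS) ∘S assocS p m₂ m₃)
        ≈⟨ ⊗S-∘S f (k ⊗S idS) idS idS ∘ fun (assocS p m₂ m₃) ⟨
      fun (((f ∘S (k ⊗S idS)) ⊗S idS) ∘S assocS p m₂ m₃)
        ∎
      where open SetoidReasoning (Fin (p + (m₂ + m₃)) →-setoid Fin (n + m₃))

    absorb-second : ∀ {q m₁ m₂ m₃ n} (k : Surj q m₂) (f : Surj (m₁ + m₂) n) →
                    ((f ⊗S idS) ∘S assocS m₁ m₂ m₃ ∘S (idS {m₁} ⊗S (k ⊗S idS {m₃})))
                      ≈ₛ (((f ∘S (idS ⊗S k)) ⊗S idS) ∘S assocS m₁ q m₃)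
    absorb-second {q} {m₁} {m₂} {m₃} {n} k f = begin
      fun ((f ⊗S idS) ∘S assocS m₁ m₂ m₃ ∘S (idS {m₁} ⊗S (k ⊗S idS {m₃})))
        ≈⟨ cong (fun (f ⊗S idS)) ∘ assocS-natural (idS {m₁}) k (idS {m₃}) ⟩
      fun ((f ⊗S idS {m₃}) ∘S ((idS {m₁} ⊗S k) ⊗S idS) ∘S assocS m₁ q m₃)
        ≈⟨ ⊗S-∘S f (idS ⊗S k) idS idS ∘ fun (assocS m₁ q m₃) ⟨
      fun (((f ∘S (idS ⊗S k)) ⊗S idS) ∘S assocS m₁ q m₃)
        ∎
      where open SetoidReasoning (Fin (m₁ + (q + m₃)) →-setoid Fin (n + m₃))

    absorb-third : ∀ {q m₁ m₂ m₃ n} (k : Surj q m₃) (f : Surj (m₁ + m₂) n) →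
                   ((f ⊗S idS) ∘S assocS m₁ m₂ m₃ ∘S (idS {m₁} ⊗S (idS {m₂} ⊗S k)))
                     ≈ₛ ((idS ⊗S k) ∘S (f ⊗S idS {q}) ∘S assocS m₁ m₂ q)
    absorb-third {q} {m₁} {m₂} {m₃} {n} k f = begin
      fun ((f ⊗S idS) ∘S assocS m₁ m₂ m₃ ∘S (idS {m₁} ⊗S (idS {m₂} ⊗S k)))
        ≈⟨ cong (fun (f ⊗S idS)) ∘ assocS-natural (idS {m₁}) (idS {m₂}) k ⟩
      fun ((f ⊗S idS {m₃}) ∘S ((idS {m₁} ⊗S idS {m₂}) ⊗S k) ∘S assocS m₁ m₂ q)
        ≈⟨ ⊗S-∘S f (idS {m₁} ⊗S idS {m₂}) (idS {m₃}) k ∘ fun (assocS m₁ m₂ q) ⟨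
      fun (((f ∘S (idS {m₁} ⊗S idS {m₂})) ⊗S k) ∘S assocS m₁ m₂ q)
        ≈⟨ ⊗S-cong (f ∘S (idS {m₁} ⊗S idS {m₂})) f k k (cong (fun f) ∘ idS⊗S-idS m₁ m₂) (λ _ → refl)
             ∘ fun (assocS m₁ m₂ q) ⟩
      fun ((f ⊗S k) ∘S assocS m₁ m₂ q)
        ≈⟨ ⊗S-∘S (idS {n}) f k (idS {q}) ∘ fun (assocS m₁ m₂ q) ⟩
      fun ((idS ⊗S k) ∘S (f ⊗S idS {q}) ∘S assocS m₁ m₂ q)
        ∎
      where open SetoidReasoning (Fin (m₁ + (m₂ + q)) →-setoid Fin (n + m₃))

    in-first-factor : ∀ {m m₃ n} (z : Ob Z m₃) (g : Surj (m + m₃) n) →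
                      (λ t → app (α̂ X Y Z) ⟦ t , z , g ⟧) Preserves DayEq X Y ⟶ DayEq X (Y ⊗̂ Z)
    in-first-factor z g =
      preserves-DayEq (DaySetoid X (Y ⊗̂ Z) _) (λ t → app (α̂ X Y Z) ⟦ t , z , g ⟧)
        (λ {h = f} {f′} p q r →
           d-cong p (d-congˡ reflZ q) (cong (fun g) ∘ (⊗S-cong f f′ idS idS r (λ _ → refl) ∘ _)))
        (λ k x y f → d-trans (d-left k x _ _) (d-cong reflX d-refl (cong (fun g) ∘ absorb-first k f)))
        (λ k x y f →
           d-trans (d-congʳ reflX (pair-actˡ reflY reflZ k y z))
                   (d-trans (d-right (k ⊗S idS) x ⟦ y , z , idS ⟧ _)
                            (d-cong reflX d-refl (cong (fun g) ∘ absorb-second k f))))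

  α̂⁻¹-hom : Hom (X ⊗̂ (Y ⊗̂ Z)) ((X ⊗̂ Y) ⊗̂ Z)
  α̂⁻¹-hom = record
    { η      = α̂⁻¹ X Y Z
    ; η-cong = preserves-DayEq (DaySetoid (X ⊗̂ Y) Z _) (app (α̂⁻¹ X Y Z))
        (λ {x = x} {h = g} p q r →
           d-trans (in-second-factor x g q) (d-cong (d-congˡ reflY p) reflZ (r ∘ _)))
        (λ { k x (⟦_,_,_⟧ {m₂} {m₃} y z f) g →
           d-trans (d-congˡ reflZ (pair-actˡ reflX reflY k x y))
                   (d-trans (d-left (k ⊗S idS) ⟦ x , y , idS ⟧ z _)
                            (d-cong d-refl reflZ (cong (fun g) ∘ absorb⁻¹-first {m₂ = m₂} {m₃} k f))) })
        (λ { k x ⟦ y , z , f ⟧ g → d-cong d-refl reflZ (cong (fun g) ∘ (⊗S-∘S idS idS k f ∘ _)) })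
    ; η-nat  = λ _ _ → d-cong d-refl reflZ (λ _ → refl)
    }
    where
    absorb⁻¹-first : ∀ {p m₁ m₂ m₃ n} (k : Surj p m₁) (f : Surj (m₂ + m₃) n) →
                     ((idS ⊗S f) ∘S assocS⁻¹ m₁ m₂ m₃ ∘S ((k ⊗S idS {m₂}) ⊗S idS {m₃}))
                       ≈ₛ ((k ⊗S idS) ∘S (idS {p} ⊗S f) ∘S assocS⁻¹ p m₂ m₃)
    absorb⁻¹-first {p} {m₁} {m₂} {m₃} {n} k f = begin
      fun ((idS ⊗S f) ∘S assocS⁻¹ m₁ m₂ m₃ ∘S ((k ⊗S idS {m₂}) ⊗S idS {m₃}))
        ≈⟨ cong (fun (idS ⊗S f)) ∘ assocS⁻¹-natural k (idS {m₂}) (idS {m₃}) ⟩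
      fun ((idS {m₁} ⊗S f) ∘S (k ⊗S (idS {m₂} ⊗S idS {m₃})) ∘S assocS⁻¹ p m₂ m₃)
        ≈⟨ ⊗S-∘S (idS {m₁}) k f (idS {m₂} ⊗S idS {m₃}) ∘ fun (assocS⁻¹ p m₂ m₃) ⟨
      fun ((k ⊗S (f ∘S (idS {m₂} ⊗S idS {m₃}))) ∘S assocS⁻¹ p m₂ m₃)
        ≈⟨ ⊗S-cong k k (f ∘S (idS {m₂} ⊗S idS {m₃})) f (λ _ → refl) (cong (fun f) ∘ idS⊗S-idS m₂ m₃)
             ∘ fun (assocS⁻¹ p m₂ m₃) ⟩
      fun ((k ⊗S f) ∘S assocS⁻¹ p m₂ m₃)
        ≈⟨ ⊗S-∘S k (idS {p}) (idS {n}) f ∘ fun (assocS⁻¹ p m₂ m₃) ⟩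
      fun ((k ⊗S idS) ∘S (idS {p} ⊗S f) ∘S assocS⁻¹ p m₂ m₃)
        ∎
      where open SetoidReasoning (Fin ((p + m₂) + m₃) →-setoid Fin (m₁ + n))

    absorb⁻¹-second : ∀ {q m₁ m₂ m₃ n} (k : Surj q m₂) (f : Surj (m₂ + m₃) n) →
                      ((idS {m₁} ⊗S f) ∘S assocS⁻¹ m₁ m₂ m₃ ∘S ((idS {m₁} ⊗S k) ⊗S idS {m₃}))
                        ≈ₛ ((idS {m₁} ⊗S (f ∘S (k ⊗S idS))) ∘S assocS⁻¹ m₁ q m₃)
    absorb⁻¹-second {q} {m₁} {m₂} {m₃} {n} k f = begin
      fun ((idS {m₁} ⊗S f) ∘S assocS⁻¹ m₁ m₂ m₃ ∘S ((idS {m₁} ⊗S k) ⊗S idS {m₃}))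
        ≈⟨ cong (fun (idS {m₁} ⊗S f)) ∘ assocS⁻¹-natural (idS {m₁}) k (idS {m₃}) ⟩
      fun ((idS {m₁} ⊗S f) ∘S (idS {m₁} ⊗S (k ⊗S idS {m₃})) ∘S assocS⁻¹ m₁ q m₃)
        ≈⟨ ⊗S-∘S (idS {m₁}) (idS {m₁}) f (k ⊗S idS) ∘ fun (assocS⁻¹ m₁ q m₃) ⟨
      fun ((idS {m₁} ⊗S (f ∘S (k ⊗S idS))) ∘S assocS⁻¹ m₁ q m₃)
        ∎
      where open SetoidReasoning (Fin ((m₁ + q) + m₃) →-setoid Fin (m₁ + n))

    absorb⁻¹-third : ∀ {q m₁ m₂ m₃ n} (k : Surj q m₃) (f : Surj (m₂ + m₃) n) →
                     ((idS {m₁} ⊗S f) ∘S assocS⁻¹ m₁ m₂ m₃ ∘S (idS {m₁ + m₂} ⊗S k))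
                       ≈ₛ ((idS {m₁} ⊗S (f ∘S (idS ⊗S k))) ∘S assocS⁻¹ m₁ m₂ q)
    absorb⁻¹-third {q} {m₁} {m₂} {m₃} {n} k f = begin
      fun ((idS {m₁} ⊗S f) ∘S assocS⁻¹ m₁ m₂ m₃ ∘S (idS {m₁ + m₂} ⊗S k))
        ≈⟨ cong (fun ((idS {m₁} ⊗S f) ∘S assocS⁻¹ m₁ m₂ m₃))
             ∘ ⊗S-cong idS (idS {m₁} ⊗S idS {m₂}) k k (sym ∘ idS⊗S-idS m₁ m₂) (λ _ → refl) ⟩
      fun ((idS {m₁} ⊗S f) ∘S assocS⁻¹ m₁ m₂ m₃ ∘S ((idS {m₁} ⊗S idS {m₂}) ⊗S k))
        ≈⟨ cong (fun (idS {m₁} ⊗S f)) ∘ assocS⁻¹-natural (idS {m₁}) (idS {m₂}) k ⟩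
      fun ((idS {m₁} ⊗S f) ∘S (idS {m₁} ⊗S (idS {m₂} ⊗S k)) ∘S assocS⁻¹ m₁ m₂ q)
        ≈⟨ ⊗S-∘S (idS {m₁}) (idS {m₁}) f (idS ⊗S k) ∘ fun (assocS⁻¹ m₁ m₂ q) ⟨
      fun ((idS {m₁} ⊗S (f ∘S (idS ⊗S k))) ∘S assocS⁻¹ m₁ m₂ q)
        ∎
      where open SetoidReasoning (Fin ((m₁ + m₂) + q) →-setoid Fin (m₁ + n))

    in-second-factor : ∀ {m₁ m n} (x : Ob X m₁) (g : Surj (m₁ + m) n) →
                       (λ t → app (α̂⁻¹ X Y Z) ⟦ x , t , g ⟧) Preserves DayEq Y Z ⟶ DayEq (X ⊗̂ Y) Z
    in-second-factor x g =
      preserves-DayEq (DaySetoid (X ⊗̂ Y) Z _) (λ t → app (α̂⁻¹ X Y Z) ⟦ x , t , g ⟧)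
        (λ {h = f} {f′} p q r →
           d-cong (d-congʳ reflX p) q (cong (fun g) ∘ (⊗S-cong idS idS f f′ (λ _ → refl) r ∘ _)))
        (λ k y z f →
           d-trans (d-congˡ reflZ (pair-actʳ reflX reflY k x y))
                   (d-trans (d-left (idS ⊗S k) ⟦ x , y , idS ⟧ z _)
                            (d-cong d-refl reflZ (cong (fun g) ∘ absorb⁻¹-second k f))))
        (λ k y z f →
           d-trans (d-right k ⟦ x , y , idS ⟧ z _) (d-cong d-refl reflZ (cong (fun g) ∘ absorb⁻¹-third k f)))

module _ {X : PSh} (P : IsPresheaf X) where
  open IsPresheaf P

  Ob-setoid : ℕ → Setoid 0ℓ 0ℓ
  Ob-setoid n = record { Carrier = Ob X n ; _≈_ = Eq X ; isEquivalence = isEquiv n }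

  act-commutes : ∀ {a b b′ c} {g : Surj b c} {f : Surj a b} {g′ : Surj b′ c} {f′ : Surj a b′} →
                 (g ∘S f) ≈ₛ (g′ ∘S f′) → ∀ x → Eq X (act X g (act X f x)) (act X g′ (act X f′ x))
  act-commutes {a} {c = c} {g} {f} {g′} {f′} p x = begin
    act X g (act X f x)     ≈⟨ act-∘ g f x ⟨
    act X (g ∘S f) x        ≈⟨ act-cong p (IsEquivalence.refl (isEquiv a)) ⟩
    act X (g′ ∘S f′) x      ≈⟨ act-∘ g′ f′ x ⟩
    act X g′ (act X f′ x)   ∎
    where open SetoidReasoning (Ob-setoid c)

  swap-hom : Hom (δ (δ X)) (δ (δ X))
  swap-hom = record
    { η      = swap X
    ; η-cong = act-cong (λ _ → refl)
    ; η-nat  = λ g → act-commutes (swapS-natural g)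
    }

σ†-preservesEq : ∀ X (σ : Hom (δ X ⊗̂ X) X) ν → PreservesEq (σ† X σ ν)
σ†-preservesEq X σ ν (inj₁ p)        = η-cong σ p
σ†-preservesEq X σ ν (inj₂ (inj₁ p)) = η-cong σ p
σ†-preservesEq X σ ν (inj₂ (inj₂ p)) = η-cong σ p

Σ†₁-preservesEq : ∀ {X X′ Y Y′} → EqReflexive X′ → EqReflexive Y′ →
                  (f : Hom X X′) (g : Hom Y Y′) → PreservesEq (Σ†₁ (η f) (η g))
Σ†₁-preservesEq reflX′ reflY′ f g (inj₁ p)        =
  inj₁ (η-cong (⊗-hom (δ-hom g) f reflY′ reflX′) p)
Σ†₁-preservesEq reflX′ reflY′ f g (inj₂ (inj₁ p)) =
  inj₂ (inj₁ (η-cong (⊗-hom (δ-hom f) g reflX′ reflY′) p))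
Σ†₁-preservesEq reflX′ reflY′ f g (inj₂ (inj₂ p)) =
  inj₂ (inj₂ (η-cong (⊗-hom (δ-hom g) g reflY′ reflY′) p))

strSub-preservesEq : ∀ Y Z → EqReflexive Y → EqReflexive Z → PreservesEq (strSub Y Z)
strSub-preservesEq Y Z reflY reflZ p =
  η-cong (⊗-hom (str-hom Y Z reflY reflZ) (id-hom (Y ⊗̂ Z) d-refl) d-refl d-refl) (
  η-cong (α̂-hom (δ Y ⊗̂ Z) Y Z d-refl reflY reflZ) (
  η-cong (⊗-hom (α̂⁻¹-hom (δ Y) Z Y reflY reflZ reflY) (id-hom Z reflZ) d-refl reflZ) (
  η-cong (⊗-hom (⊗-hom (id-hom (δ Y) reflY) (γ̂-hom Y Z reflY reflZ) reflY d-refl)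
                (id-hom Z reflZ) d-refl reflZ) (
  η-cong (⊗-hom (α̂-hom (δ Y) Y Z reflY reflY reflZ) (id-hom Z reflZ) d-refl reflZ) (
  η-cong (α̂⁻¹-hom (δ Y ⊗̂ Y) Z Z d-refl reflZ reflZ) (
  η-cong (⊗-hom (id-hom (δ Y ⊗̂ Y) d-refl) (dg-hom Z reflZ) d-refl d-refl) p))))))

strSub†-preservesEqˡ : ∀ X Y Z → EqReflexive X → EqReflexive Y → EqReflexive Z →
                       PreservesEqˡ (strSub† X Y Z)
strSub†-preservesEqˡ X Y Z reflX reflY reflZ z h (inj₁ p) =
  inj₁ (η-cong (⊗-hom (str-hom Y Z reflY reflZ) (id-hom X reflX) d-refl reflX) (
        η-cong (α̂⁻¹-hom (δ Y) Z X reflY reflZ reflX) (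
        η-cong (⊗-hom (id-hom (δ Y) reflY) (γ̂-hom X Z reflX reflZ) reflY d-refl) (
        η-cong (α̂-hom (δ Y) X Z reflY reflX reflZ) (d-congˡ {y = z} {h = h} reflZ p)))))
strSub†-preservesEqˡ X Y Z reflX reflY reflZ z h (inj₂ (inj₁ p)) =
  inj₂ (inj₁ (η-cong (α̂-hom (δ X) Y Z reflX reflY reflZ) (d-congˡ {y = z} {h = h} reflZ p)))
strSub†-preservesEqˡ X Y Z reflX reflY reflZ z h (inj₂ (inj₂ p)) =
  inj₂ (inj₂ (strSub-preservesEq Y Z reflY reflZ (d-congˡ {y = z} {h = h} reflZ p)))

module _ {A B Z T : PSh} (T-isEquiv : ∀ n → IsEquivalence (Eq T {n}))
         (K : Comp A B) (H : Comp B A) (K∙H≐id : (K ∙ H) ≐ idC B) (H∙K≐id : (H ∙ K) ≐ idC A)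
         (L : Comp (B ⊗̂ Z) T) (R : Comp (A ⊗̂ Z) T) (L-cong : PreservesEqˡ L) (R-cong : PreservesEqˡ R)
         where

  ⊗₁-transpose : ((L ∙ (K ⊗₁ idC Z)) ≐ R) ⇔ (L ≐ (R ∙ (H ⊗₁ idC Z)))
  ⊗₁-transpose = mk⇔ to from
    where
    to : (L ∙ (K ⊗₁ idC Z)) ≐ R → L ≐ (R ∙ (H ⊗₁ idC Z))
    to e n ⟦ u , z , h ⟧ = ≈-trans (≈-sym (L-cong z h (K∙H≐id _ u))) (e n ⟦ app H u , z , h ⟧)
      where open IsEquivalence (T-isEquiv n) using () renaming (sym to ≈-sym; trans to ≈-trans)

    from : L ≐ (R ∙ (H ⊗₁ idC Z)) → (L ∙ (K ⊗₁ idC Z)) ≐ R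
    from e n ⟦ w , z , h ⟧ = ≈-trans (e n ⟦ app K w , z , h ⟧) (R-cong z h (H∙K≐id _ w))
      where open IsEquivalence (T-isEquiv n) using () renaming (trans to ≈-trans)

-- δ(A ⊗̂ B) ≅ Leibniz A B through strAll A B.
Leibniz : PSh → PSh → PSh
Leibniz A B = δ A ⊗̂ B ⊕ A ⊗̂ δ B ⊕ δ A ⊗̂ δ B

module _ (X : PSh) (P : IsPresheaf X) (σ : Hom (δ X ⊗̂ X) X) (ν : Hom J (δ X)) where
  open IsPresheaf P

  private
    reflX : EqReflexive X
    reflX {n} = IsEquivalence.refl (isEquiv n)

  substTwice : Comp (δ (δ X ⊗̂ X) ⊗̂ X) X
  substTwice = η σ ∙ (δ₁ (η σ) ⊗₁ idC X)

  swapSummands : Comp (Leibniz (δ X) X) (Σ† X (δ X))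
  swapSummands = (swap X ⊗₁ idC X) ⊕₁ idC (δ X ⊗̂ δ X) ⊕₁ (swap X ⊗₁ idC (δ X))

  -- ExtSubst X σ ν H unfolds to substTwice ≐ (substSummands ∙ (H ⊗₁ idC X)).
  substSummands : Comp (Leibniz (δ X) X ⊗̂ X) X
  substSummands = σ† X σ ν ∙ Σ†₁ (idC X) (η σ) ∙ strSub† X (δ X) X ∙ (swapSummands ⊗₁ idC X)

  substTwice-preservesEqˡ : PreservesEqˡ substTwice
  substTwice-preservesEqˡ x h p = η-cong σ (d-congˡ reflX (η-cong σ p))

  swapSummands-preservesEq : PreservesEq swapSummands
  swapSummands-preservesEq (inj₁ p)        =
    inj₁ (η-cong (⊗-hom (swap-hom P) (id-hom X reflX) reflX reflX) p)
  swapSummands-preservesEq (inj₂ (inj₁ p)) = inj₂ (inj₁ p)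
  swapSummands-preservesEq (inj₂ (inj₂ p)) =
    inj₂ (inj₂ (η-cong (⊗-hom (swap-hom P) (id-hom (δ X) reflX) reflX reflX) p))

  substSummands-preservesEqˡ : PreservesEqˡ substSummands
  substSummands-preservesEqˡ x h p =
    σ†-preservesEq X σ ν
      (Σ†₁-preservesEq reflX reflX (id-hom X reflX) σ
        (strSub†-preservesEqˡ X (δ X) X reflX reflX reflX x h (swapSummands-preservesEq p)))

  Ax-cdf : Set
  Ax-cdf = Ax-c X σ ν × Ax-d X σ ν × Ax-f X σ ν

  cdf⇔summands : Ax-cdf ⇔ ((substTwice ∙ (strAll (δ X) X ⊗₁ idC X)) ≐ substSummands)
  cdf⇔summands = mk⇔ to from
    where
    to : Ax-cdf → (substTwice ∙ (strAll (δ X) X ⊗₁ idC X)) ≐ substSummands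
    to (c , d , f) n ⟦ inj₁ v , x , h ⟧        = d n ⟦ v , x , h ⟧
    to (c , d , f) n ⟦ inj₂ (inj₁ v) , x , h ⟧ = IsEquivalence.sym (isEquiv n) (c n ⟦ v , x , h ⟧)
    to (c , d , f) n ⟦ inj₂ (inj₂ v) , x , h ⟧ = f n ⟦ v , x , h ⟧

    from : (substTwice ∙ (strAll (δ X) X ⊗₁ idC X)) ≐ substSummands → Ax-cdf
    from e = c , d , f
      where
      c : Ax-c X σ ν
      c n ⟦ v , x , h ⟧ = IsEquivalence.sym (isEquiv n) (e n ⟦ inj₂ (inj₁ v) , x , h ⟧)
      d : Ax-d X σ ν
      d n ⟦ v , x , h ⟧ = e n ⟦ inj₁ v , x , h ⟧
      f : Ax-f X σ ν
      f n ⟦ v , x , h ⟧ = e n ⟦ inj₂ (inj₂ v) , x , h ⟧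

  cdf⇔ExtSubst : ∀ H → IsInverseH (δ X) X H → Ax-cdf ⇔ ExtSubst X σ ν H
  cdf⇔ExtSubst H (_ , strAll∙H≐id , H∙strAll≐id) =
    ⇔-trans cdf⇔summands
            (⊗₁-transpose isEquiv (strAll (δ X) X) H strAll∙H≐id H∙strAll≐id
                          substTwice substSummands substTwice-preservesEqˡ substSummands-preservesEqˡ)

mainTheorem5 : (X : PSh) → IsPresheaf X →
    (σ : Hom (δ X ⊗̂ X) X) (ν : Hom J (δ X)) →
    (H : Comp (δ (δ X ⊗̂ X)) (δ (δ X) ⊗̂ X ⊕ δ X ⊗̂ δ X ⊕ δ (δ X) ⊗̂ δ X)) →
    IsInverseH (δ X) X H →
    IsRelevantSubstitutionAlgebra X σ ν ⇔ (Ax-a X σ ν × Ax-b X σ ν × ExtSubst X σ ν H)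
mainTheorem5 X P σ ν H inverse = ⇔-refl ×-⇔ ⇔-refl ×-⇔ cdf⇔ExtSubst X P σ ν H inverse
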